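{- Let $T:=\frac{1}{V(N)}\sum_{j_+(N)\le j<j_-(N)}\tau(n_j)$, suppose $\frac{1}{V(N)}\sum_{j_+(N)\le j<j_-(N)}(\tau(n_j)-T)^2\le\varepsilon_N^2T^2$ for some sequence $\varepsilon_N\to0$, let $\eta_N\to0$ with $\varepsilon_N/\eta_N\to0$, and let $A_N:=\{j_+(N)\le j<j_-(N):|\tau(n_j)-T|\le\eta_NT\}$. List the orbit values $n_j$, $j\in A_N$, in decreasing order as $m_1>m_2>\cdots>m_r$, where $r\asymp N/T$. Then for all but $o(r)$ indices $i$, \[ m_{i+1}=m_i-T+o(T),\qquad \tau(m_i)=T+o(T). \]
   Context: $\tau(n)$ is the number of positive divisors of $n$. Fix $x$ and the orbit $n_0=x$, $n_{j+1}=n_j-\tau(n_j)$. For $N\ge1$ let $j_+(N):=\min\{j:n_j\le2N\}$, $j_-(N):=\min\{j:n_j\le N\}$, $V(N):=j_-(N)-j_+(N)$. Asymptotic notation refers to $N\to\infty$. -}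

module Defs where

open import Data.Nat using (ℕ; zero; suc; _+_; _*_; _∸_; _≤?_; _<?_)
open import Data.Nat.Divisibility using (_∣?_)
open import Data.List using (List; []; _∷_; length; filter; map; upTo)
open import Data.Integer using (+_)
open import Data.Product using (_×_)
open import Relation.Nullary using (Dec; yes; no; ¬_)
open import Relation.Nullary.Decidable using (_×-dec_; _→-dec_; ¬?)
open import Data.Rational as Q using (ℚ)
import Data.Rational.Properties as QP

-- number of positive divisors; τ 0 = 0 by convention (never used on the window)
τ : ℕ → ℕ
τ n = length (filter (_∣? n) (map suc (upTo n)))

-- the orbit n_0 = x, n_{j+1} = n_j - τ(n_j)  (truncated subtraction; n - τ n ≥ 0 anyway)
orbit : ℕ → ℕ → ℕ
orbit x zero = x
orbit x (suc j) = orbit x j ∸ τ (orbit x j)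

firstFrom : ℕ → ℕ → ℕ → ℕ → ℕ
firstFrom x M j zero = j
firstFrom x M j (suc f) with orbit x j ≤? M
... | yes _ = j
... | no _ = firstFrom x M (suc j) f

-- min { j : n_j ≤ M }  (the orbit reaches 0 within x steps, so searching j ≤ x suffices)
jFirst : ℕ → ℕ → ℕ
jFirst x M = firstFrom x M 0 x

jPlus jMinus V : ℕ → ℕ → ℕ
jPlus x N = jFirst x (2 * N)
jMinus x N = jFirst x N
V x N = jMinus x N ∸ jPlus x N

window : ℕ → ℕ → List ℕ
window x N = map (λ k → jPlus x N + k) (upTo (V x N))

toℚ : ℕ → ℚ
toℚ n = (+ n) Q./ 1

sumℚ : List ℚ → ℚ
sumℚ [] = Q.0ℚ
sumℚ (q ∷ qs) = q Q.+ sumℚ qs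

-- q / v  (only used with v > 0)
divℕ : ℚ → ℕ → ℚ
divℕ q zero = Q.0ℚ
divℕ q (suc v) = q Q.* ((+ 1) Q./ suc v)

τj : ℕ → ℕ → ℚ
τj x j = toℚ (τ (orbit x j))

Tval : ℕ → ℕ → ℚ
Tval x N = divℕ (sumℚ (map (τj x) (window x N))) (V x N)

Var : ℕ → ℕ → ℚ
Var x N = divℕ (sumℚ (map (λ j → (τj x j Q.- Tval x N) Q.* (τj x j Q.- Tval x N)) (window x N))) (V x N)

Aset : ℕ → ℕ → ℚ → List ℕ
Aset x N η = filter (λ j → Q.∣ τj x j Q.- Tval x N ∣ QP.≤? η Q.* Tval x N) (window x N)

-- m_1 > m_2 > ... > m_r  (orbit is strictly decreasing on the window, so increasing j = decreasing value)
mList : ℕ → ℕ → ℚ → List ℕ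
mList x N η = map (orbit x) (Aset x N η)

rval : ℕ → ℕ → ℚ → ℕ
rval x N η = length (mList x N η)

nth : List ℕ → ℕ → ℕ
nth [] i = 0
nth (a ∷ as) zero = a
nth (a ∷ as) (suc i) = nth as i

-- index i (0-based) is good with tolerance δ:
-- |τ(m_i) - T| ≤ δT, and if m_{i+1} exists, |m_{i+1} - (m_i - T)| ≤ δT
Good : ℕ → ℕ → ℚ → ℚ → ℕ → Set
Good x N η δ i =
  (Q.∣ toℚ (τ (nth (mList x N η) i)) Q.- Tval x N ∣ Q.≤ δ Q.* Tval x N) ×
  (suc i Data.Nat.< rval x N η →
     Q.∣ toℚ (nth (mList x N η) (suc i)) Q.- (toℚ (nth (mList x N η) i) Q.- Tval x N) ∣ Q.≤ δ Q.* Tval x N)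

good? : ∀ x N η δ i → Dec (Good x N η δ i)
good? x N η δ i =
  (Q.∣ toℚ (τ (nth (mList x N η) i)) Q.- Tval x N ∣ QP.≤? δ Q.* Tval x N) ×-dec
  ((suc i <? rval x N η) →-dec
     (Q.∣ toℚ (nth (mList x N η) (suc i)) Q.- (toℚ (nth (mList x N η) i) Q.- Tval x N) ∣ QP.≤? δ Q.* Tval x N))

badCount : ℕ → ℕ → ℚ → ℚ → ℕ
badCount x N η δ = length (filter (λ i → ¬? (good? x N η δ i)) (upTo (rval x N η)))

TendsToZero : (ℕ → ℚ) → Set
TendsToZero f = ∀ (δ : ℚ) → Q.0ℚ Q.< δ → Data.Product.∃ λ N₀ → ∀ N → N₀ Data.Nat.≤ N → Q.∣ f N ∣ Q.≤ δ

-- ε_N / η_N → 0  (η_N > 0), written as |ε_N| ≤ δ η_N eventually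
RatioToZero : (ℕ → ℚ) → (ℕ → ℚ) → Set
RatioToZero ε η = ∀ (δ : ℚ) → Q.0ℚ Q.< δ → Data.Product.∃ λ N₀ → ∀ N → N₀ Data.Nat.≤ N → Q.∣ ε N ∣ Q.≤ δ Q.* η N

{-# OPTIONS --safe #-}

-- Chebyshev's inequality bounds the number b of window indices outside A_N:
-- b (ηT)² ≤ Σ (τ(n_j) − T)² = V·Var ≤ V ε² T², so b ≤ ρ² V once |ε| ≤ ρη, and since
-- V = r + b this gives b ≤ δ r for large N. The window indices are consecutive, so the
-- increasing enumeration of A_N steps from j to j + 1 at all but at most b places, and at
-- such a step the orbit gives m_{i+1} = m_i − τ(m_i) with |τ(m_i) − T| ≤ ηT ≤ δT.
-- Hence at most b ≤ δ r indices are bad.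

module Submission where

open import Defs
open import Data.Nat using (ℕ; _≤_; _<_; zero; suc; z≤n; s≤s; s≤s⁻¹; _≟_; _<?_; _⊔_)
import Data.Nat as ℕ
import Data.Nat.Properties as ℕP
import Data.Nat.Coprimality as Coprime
open import Data.Nat.Divisibility using (_∣?_)
open import Data.Integer using (+_)
import Data.Integer as ℤ
import Data.Integer.Properties as ℤP
open import Data.Product using (∃; _×_; _,_; proj₁; proj₂)
open import Data.Sum using (_⊎_; inj₁; inj₂; map₂)
open import Data.Rational as Q using (ℚ; mkℚ; 0ℚ; ½; ∣_∣)
import Data.Rational.Properties as QP
open import Data.Rational.Solver using (module +-*-Solver)
open +-*-Solver using (solve; con; _:+_; _:*_; _:-_; :-_; _:=_)
open import Data.List using (List; []; _∷_; length; filter; map; upTo; applyUpTo; iterate)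
import Data.List.Properties as LP
open import Data.List.Relation.Unary.All using (All; _∷_)
open import Data.List.Relation.Unary.All.Properties using (all-filter)
open import Function using (id; _∘_)
open import Relation.Binary.PropositionalEquality
open import Relation.Nullary using (Dec; yes; no; ¬_; contradiction)
open import Relation.Nullary.Decidable using (_×-dec_; ¬?; toWitness; decidable-stable)
open import Relation.Unary using (Decidable)

toℚ≡mkℚ : ∀ n → toℚ n ≡ mkℚ (+ n) 0 (Coprime.sym (Coprime.1-coprimeTo n))
toℚ≡mkℚ n = QP.normalize-coprime (Coprime.sym (Coprime.1-coprimeTo n))

toℚ-+ : ∀ m n → toℚ (m ℕ.+ n) ≡ toℚ m Q.+ toℚ n
toℚ-+ m n rewrite toℚ≡mkℚ m | toℚ≡mkℚ n =
  cong₂ (λ a b → (a ℤ.+ b) Q./ 1) (sym (ℤP.*-identityʳ (+ m))) (sym (ℤP.*-identityʳ (+ n)))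

0≤toℚ : ∀ n → 0ℚ Q.≤ toℚ n
0≤toℚ n = QP.nonNegative⁻¹ (toℚ n) {{QP.normalize-nonNeg n 1}}

p≤p+q : ∀ p {q} → 0ℚ Q.≤ q → p Q.≤ p Q.+ q
p≤p+q p {q} 0≤q = subst (Q._≤ p Q.+ q) (QP.+-identityʳ p) (QP.+-monoʳ-≤ p 0≤q)

p≤q+p : ∀ p {q} → 0ℚ Q.≤ q → p Q.≤ q Q.+ p
p≤q+p p {q} 0≤q = subst (p Q.≤_) (QP.+-comm p q) (p≤p+q p 0≤q)

toℚ-mono-≤ : ∀ {m n} → m ≤ n → toℚ m Q.≤ toℚ n
toℚ-mono-≤ {m} {n} m≤n = subst (toℚ m Q.≤_) toℚm+[n∸m]≡toℚn (p≤p+q (toℚ m) (0≤toℚ (n ℕ.∸ m)))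
  where
  toℚm+[n∸m]≡toℚn : toℚ m Q.+ toℚ (n ℕ.∸ m) ≡ toℚ n
  toℚm+[n∸m]≡toℚn = trans (sym (toℚ-+ m (n ℕ.∸ m))) (cong toℚ (ℕP.m+[n∸m]≡n m≤n))

p+q-q≡p : ∀ p q → (p Q.+ q) Q.- q ≡ p
p+q-q≡p = solve 2 (λ p q → (p :+ q) :- q := p) refl

toℚ-∸ : ∀ m n → n ≤ m → toℚ (m ℕ.∸ n) ≡ toℚ m Q.- toℚ n
toℚ-∸ m n n≤m = begin
  toℚ (m ℕ.∸ n)                       ≡⟨ sym (p+q-q≡p _ _) ⟩
  (toℚ (m ℕ.∸ n) Q.+ toℚ n) Q.- toℚ n ≡⟨ cong (Q._- toℚ n) (sym (toℚ-+ (m ℕ.∸ n) n)) ⟩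
  toℚ (m ℕ.∸ n ℕ.+ n) Q.- toℚ n       ≡⟨ cong (λ k → toℚ k Q.- toℚ n) (ℕP.m∸n+n≡m n≤m) ⟩
  toℚ m Q.- toℚ n                     ∎
  where open ≡-Reasoning

toℚ-*-divℕ : ∀ q n → 0 < n → toℚ n Q.* divℕ q n ≡ q
toℚ-*-divℕ q (suc v) _ rewrite toℚ≡mkℚ (suc v) | QP.normalize-coprime {1} {v} (Coprime.1-coprimeTo (suc v)) =
  begin
    n Q.* (q Q.* Q.1/ n) ≡⟨ left-comm n q (Q.1/ n) ⟩
    q Q.* (n Q.* Q.1/ n) ≡⟨ cong (q Q.*_) (QP.*-inverseʳ n) ⟩
    q Q.* Q.1ℚ           ≡⟨ QP.*-identityʳ q ⟩
    q                    ∎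
  where
  open ≡-Reasoning
  n : ℚ
  n = mkℚ (+ suc v) 0 (Coprime.sym (Coprime.1-coprimeTo (suc v)))
  left-comm : ∀ a b c → a Q.* (b Q.* c) ≡ b Q.* (a Q.* c)
  left-comm = solve 3 (λ a b c → a :* (b :* c) := b :* (a :* c)) refl

0≤p*q : ∀ {p q} → 0ℚ Q.≤ p → 0ℚ Q.≤ q → 0ℚ Q.≤ p Q.* q
0≤p*q {p} {q} 0≤p 0≤q =
  QP.nonNegative⁻¹ _ {{QP.nonNeg*nonNeg⇒nonNeg p {{Q.nonNegative 0≤p}} q {{Q.nonNegative 0≤q}}}}

0≤divℕ : ∀ {q} n → 0ℚ Q.≤ q → 0ℚ Q.≤ divℕ q n
0≤divℕ zero    _   = QP.≤-refl
0≤divℕ (suc v) 0≤q = 0≤p*q 0≤q (QP.nonNegative⁻¹ _ {{QP.normalize-nonNeg 1 (suc v)}})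

p*p≡∣p∣*∣p∣ : ∀ p → p Q.* p ≡ ∣ p ∣ Q.* ∣ p ∣
p*p≡∣p∣*∣p∣ p with QP.∣p∣≡p∨∣p∣≡-p p
... | inj₁ ∣p∣≡p  rewrite ∣p∣≡p  = refl
... | inj₂ ∣p∣≡-p rewrite ∣p∣≡-p = solve 1 (λ a → a :* a := (:- a) :* (:- a)) refl p

0≤p*p : ∀ p → 0ℚ Q.≤ p Q.* p
0≤p*p p = subst (0ℚ Q.≤_) (sym (p*p≡∣p∣*∣p∣ p)) (0≤p*q (QP.0≤∣p∣ p) (QP.0≤∣p∣ p))

∣p∣≤q⇒p*p≤q*q : ∀ {p q} → ∣ p ∣ Q.≤ q → p Q.* p Q.≤ q Q.* q
∣p∣≤q⇒p*p≤q*q {p} {q} ∣p∣≤q = subst (Q._≤ q Q.* q) (sym (p*p≡∣p∣*∣p∣ p))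
  (QP.≤-trans (QP.*-monoˡ-≤-nonNeg ∣ p ∣ {{QP.∣-∣-nonNeg p}} ∣p∣≤q)
              (QP.*-monoʳ-≤-nonNeg q {{Q.nonNegative (QP.≤-trans (QP.0≤∣p∣ p) ∣p∣≤q)}} ∣p∣≤q))

∣p∣≰q⇒q*q<p*p : ∀ {p q} → 0ℚ Q.≤ q → ¬ (∣ p ∣ Q.≤ q) → q Q.* q Q.< p Q.* p
∣p∣≰q⇒q*q<p*p {p} {q} 0≤q ∣p∣≰q = subst (q Q.* q Q.<_) (sym (p*p≡∣p∣*∣p∣ p))
  (QP.≤-<-trans (QP.*-monoˡ-≤-nonNeg q {{Q.nonNegative 0≤q}} (QP.<⇒≤ q<∣p∣))
                (QP.*-monoˡ-<-pos ∣ p ∣ {{Q.positive (QP.≤-<-trans 0≤q q<∣p∣)}} q<∣p∣))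
  where
  q<∣p∣ : q Q.< ∣ p ∣
  q<∣p∣ = QP.≰⇒> ∣p∣≰q

0≤sumℚ-map : ∀ {f : ℕ → ℚ} → (∀ j → 0ℚ Q.≤ f j) → ∀ js → 0ℚ Q.≤ sumℚ (map f js)
0≤sumℚ-map 0≤f []       = QP.≤-refl
0≤sumℚ-map 0≤f (j ∷ js) = QP.≤-trans (0≤sumℚ-map 0≤f js) (p≤q+p _ (0≤f j))

-- Chebyshev's inequality

module _ {P : ℕ → Set} (P? : Decidable P) where

  rejected : List ℕ → ℕ
  rejected js = length (filter (λ j → ¬? (P? j)) js)

  accepted+rejected : ∀ js → length (filter P? js) ℕ.+ rejected js ≡ length js
  accepted+rejected []       = refl
  accepted+rejected (j ∷ js) with P? j
  ... | yes _ = cong suc (accepted+rejected js)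
  ... | no _  = trans (ℕP.+-suc _ _) (cong suc (accepted+rejected js))

  rejected-∷-accept : ∀ {j js} → P j → rejected (j ∷ js) ≡ rejected js
  rejected-∷-accept Pj = cong length (LP.filter-reject (λ j → ¬? (P? j)) (λ ¬Pj → ¬Pj Pj))

  rejected-∷-reject : ∀ {j js} → ¬ P j → rejected (j ∷ js) ≡ suc (rejected js)
  rejected-∷-reject ¬Pj = cong length (LP.filter-accept (λ j → ¬? (P? j)) ¬Pj)

within? : (d : ℕ → ℚ) (e : ℚ) → Decidable (λ j → ∣ d j ∣ Q.≤ e)
within? d e j = ∣ d j ∣ QP.≤? e

module _ (d : ℕ → ℚ) (e : ℚ) where

  exceeding : List ℕ → ℕ
  exceeding = rejected (within? d e)

  sumOfSquares : List ℕ → ℚ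
  sumOfSquares js = sumℚ (map (λ j → d j Q.* d j) js)

  module _ (0≤e : 0ℚ Q.≤ e) where

    -- The strict alternative is what allows cancelling e * e in chebyshev, even when e = 0.
    NoneOrBelow : ℕ → ℚ → Set
    NoneOrBelow m S = m ≡ 0 ⊎ toℚ m Q.* (e Q.* e) Q.< S

    noneOrBelow⇒≤ : ∀ {m S} → 0ℚ Q.≤ S → NoneOrBelow m S → toℚ m Q.* (e Q.* e) Q.≤ S
    noneOrBelow⇒≤ {S = S} 0≤S (inj₁ refl) = subst (Q._≤ S) (sym (QP.*-zeroˡ (e Q.* e))) 0≤S
    noneOrBelow⇒≤         _   (inj₂ m<S)  = QP.<⇒≤ m<S

    exceeding-noneOrBelow : ∀ js → NoneOrBelow (exceeding js) (sumOfSquares js)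
    exceeding-noneOrBelow []       = inj₁ refl
    exceeding-noneOrBelow (j ∷ js) with ∣ d j ∣ QP.≤? e
    ... | yes ∣dj∣≤e = subst (λ m → NoneOrBelow m S) (sym (rejected-∷-accept (within? d e) ∣dj∣≤e))
                             (map₂ (λ m<Sjs → QP.<-≤-trans m<Sjs (p≤q+p _ (0≤p*p (d j)))) (exceeding-noneOrBelow js))
      where
      S : ℚ
      S = d j Q.* d j Q.+ sumOfSquares js
    ... | no ∣dj∣≰e  = subst (λ m → NoneOrBelow m S) (sym (rejected-∷-reject (within? d e) ∣dj∣≰e)) (inj₂ (begin-strict
      toℚ (suc m) Q.* (e Q.* e)         ≡⟨ cong (Q._* (e Q.* e)) (toℚ-+ 1 m) ⟩
      (Q.1ℚ Q.+ toℚ m) Q.* (e Q.* e)    ≡⟨ distrib (toℚ m) (e Q.* e) ⟩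
      e Q.* e Q.+ toℚ m Q.* (e Q.* e)   <⟨ QP.+-mono-<-≤ (∣p∣≰q⇒q*q<p*p 0≤e ∣dj∣≰e) m*e²≤Sjs ⟩
      S                                 ∎))
      where
      open QP.≤-Reasoning
      S : ℚ
      S = d j Q.* d j Q.+ sumOfSquares js
      m : ℕ
      m = exceeding js
      distrib : ∀ a b → (Q.1ℚ Q.+ a) Q.* b ≡ b Q.+ a Q.* b
      distrib = solve 2 (λ a b → (con Q.1ℚ :+ a) :* b := b :+ a :* b) refl
      m*e²≤Sjs : toℚ m Q.* (e Q.* e) Q.≤ sumOfSquares js
      m*e²≤Sjs = noneOrBelow⇒≤ (0≤sumℚ-map (λ i → 0≤p*p (d i)) js) (exceeding-noneOrBelow js)

    chebyshev : ∀ js k → 0ℚ Q.≤ k → sumOfSquares js Q.≤ k Q.* (e Q.* e) → toℚ (exceeding js) Q.≤ k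
    chebyshev js k 0≤k S≤ke² with exceeding js | exceeding-noneOrBelow js
    ... | _ | inj₁ refl = 0≤k
    ... | _ | inj₂ m<S  = QP.<⇒≤ (QP.*-cancelʳ-<-nonNeg (e Q.* e) {{Q.nonNegative (0≤p*p e)}} (QP.<-≤-trans m<S S≤ke²))

-- Gaps in lists of natural numbers

nth-map : ∀ (f : ℕ → ℕ) js i → i < length js → nth (map f js) i ≡ f (nth js i)
nth-map f (j ∷ js) zero    _   = refl
nth-map f (j ∷ js) (suc i) i<n = nth-map f js i (s≤s⁻¹ i<n)

All-nth : ∀ {P : ℕ → Set} {js} i → All P js → i < length js → P (nth js i)
All-nth zero    (p ∷ _)  _   = p
All-nth (suc i) (_ ∷ ps) i<n = All-nth i ps (s≤s⁻¹ i<n)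

-- nth pads with 0 past the end, hence the bound on suc i.
Gap : List ℕ → ℕ → Set
Gap js i = suc i < length js × ¬ (nth js (suc i) ≡ suc (nth js i))

gap? : ∀ js → Decidable (Gap js)
gap? js i = (suc i <? length js) ×-dec ¬? (nth js (suc i) ≟ suc (nth js i))

sucUnless : {P : Set} → Dec P → ℕ → ℕ
sucUnless (yes _) n = n
sucUnless (no _)  n = suc n

gaps : List ℕ → ℕ
gaps []               = 0
gaps (a ∷ [])         = 0
gaps (a ∷ js@(b ∷ _)) = sucUnless (b ≟ suc a) (gaps js)

gaps-∷ : ∀ a js → gaps (a ∷ js) ≤ suc (gaps js)
gaps-∷ a []       = z≤n
gaps-∷ a (b ∷ js) with b ≟ suc a
... | yes _ = ℕP.n≤1+n _
... | no _  = ℕP.≤-refl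

gaps-∷-suc : ∀ a js → gaps (a ∷ suc a ∷ js) ≡ gaps (suc a ∷ js)
gaps-∷-suc a js with suc a ≟ suc a
... | yes _    = refl
... | no sa≢sa = contradiction refl sa≢sa

Gap-∷ : ∀ {a js i} → Gap (a ∷ js) (suc i) → Gap js i
Gap-∷ (si<n , ¬next) = s≤s⁻¹ si<n , ¬next

count-≤-gaps : ∀ {Q : ℕ → Set} (Q? : Decidable Q) (f : ℕ → ℕ) js →
  (∀ i → i < length js → Q (f i) → Gap js i) →
  length (filter Q? (applyUpTo f (length js))) ≤ gaps js
count-≤-gaps Q? f [] _ = z≤n
count-≤-gaps Q? f (a ∷ []) gap with Q? (f 0)
... | yes q = contradiction (proj₁ (gap 0 (s≤s z≤n) q)) (ℕP.<-irrefl refl)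
... | no _  = z≤n
count-≤-gaps Q? f (a ∷ b ∷ js) gap
  with Q? (f 0) | b ≟ suc a | count-≤-gaps Q? (f ∘ suc) (b ∷ js) (λ i i<n q → Gap-∷ {a} (gap (suc i) (s≤s i<n) q))
... | yes q | yes b≡sa | _  = contradiction b≡sa (proj₂ (gap 0 (s≤s z≤n) q))
... | yes _ | no _     | ih = s≤s ih
... | no _  | yes _    | ih = ih
... | no _  | no _     | ih = ℕP.m≤n⇒m≤1+n ih

module _ {P : ℕ → Set} (P? : Decidable P) where

  gaps-∷-filter-iterate : ∀ a n → gaps (a ∷ filter P? (iterate suc (suc a) n)) ≤ rejected P? (iterate suc (suc a) n)
  gaps-filter-iterate   : ∀ a n → gaps (filter P? (iterate suc a n)) ≤ rejected P? (iterate suc a n)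

  gaps-∷-filter-iterate a zero = z≤n
  gaps-∷-filter-iterate a (suc n) with P? (suc a)
  ... | yes _ rewrite gaps-∷-suc a (filter P? (iterate suc (suc (suc a)) n)) = gaps-∷-filter-iterate (suc a) n
  ... | no _  = ℕP.≤-trans (gaps-∷ a (filter P? (iterate suc (suc (suc a)) n)))
                           (s≤s (gaps-filter-iterate (suc (suc a)) n))

  gaps-filter-iterate a zero = z≤n
  gaps-filter-iterate a (suc n) with P? a
  ... | yes _ = gaps-∷-filter-iterate a n
  ... | no _  = ℕP.m≤n⇒m≤1+n (gaps-filter-iterate (suc a) n)

-- The orbit on the window

τ≤n : ∀ n → τ n ≤ n
τ≤n n = ℕP.≤-trans (LP.length-filter (_∣? n) (map suc (upTo n)))
                   (ℕP.≤-reflexive (trans (LP.length-map suc (upTo n)) (LP.length-upTo n)))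

n∸t-[n-T]≡-[t-T] : ∀ n t T → t ≤ n → toℚ (n ℕ.∸ t) Q.- (toℚ n Q.- T) ≡ Q.- (toℚ t Q.- T)
n∸t-[n-T]≡-[t-T] n t T t≤n = trans (cong (Q._- (toℚ n Q.- T)) (toℚ-∸ n t t≤n)) (cancel (toℚ n) (toℚ t) T)
  where
  cancel : ∀ a b c → (a Q.- b) Q.- (a Q.- c) ≡ Q.- (b Q.- c)
  cancel = solve 3 (λ a b c → (a :- b) :- (a :- c) := :- (b :- c)) refl

applyUpTo≡iterate : ∀ (f : ℕ → ℕ) a n → (∀ k → f k ≡ a ℕ.+ k) → applyUpTo f n ≡ iterate suc a n
applyUpTo≡iterate f a zero    _    = refl
applyUpTo≡iterate f a (suc n) f≡a+ =
  cong₂ _∷_ (trans (f≡a+ 0) (ℕP.+-identityʳ a))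
            (applyUpTo≡iterate (f ∘ suc) (suc a) n (λ k → trans (f≡a+ (suc k)) (ℕP.+-suc a k)))

window≡iterate : ∀ x N → window x N ≡ iterate suc (jPlus x N) (V x N)
window≡iterate x N = trans (LP.map-upTo _ (V x N)) (applyUpTo≡iterate _ _ _ (λ _ → refl))

length-window : ∀ x N → length (window x N) ≡ V x N
length-window x N = trans (cong length (window≡iterate x N)) (LP.length-iterate suc _ _)

0≤Tval : ∀ x N → 0ℚ Q.≤ Tval x N
0≤Tval x N = 0≤divℕ (V x N) (0≤sumℚ-map (λ j → 0≤toℚ (τ (orbit x j))) (window x N))

deviation : ℕ → ℕ → ℕ → ℚ
deviation x N j = τj x j Q.- Tval x N

module _ (x N : ℕ) (η : ℚ) where

  close? : Decidable (λ j → ∣ deviation x N j ∣ Q.≤ η Q.* Tval x N)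
  close? = within? (deviation x N) (η Q.* Tval x N)

  good-unless-gap : ∀ {δ} → η Q.≤ δ → ∀ i → i < length (Aset x N η) → ¬ Gap (Aset x N η) i → Good x N η δ i
  good-unless-gap {δ} η≤δ i i<n no-gap = τ-close-at-i , step-at-i
    where
    T : ℚ
    T = Tval x N
    js ms : List ℕ
    js = Aset x N η
    ms = mList x N η
    m : ℕ
    m = orbit x (nth js i)

    mᵢ≡m : nth ms i ≡ m
    mᵢ≡m = nth-map (orbit x) js i i<n

    τ-close : ∣ toℚ (τ m) Q.- T ∣ Q.≤ δ Q.* T
    τ-close = QP.≤-trans (All-nth i (all-filter close? (window x N)) i<n)
                         (QP.*-monoʳ-≤-nonNeg T {{Q.nonNegative (0≤Tval x N)}} η≤δ)

    τ-close-at-i : ∣ toℚ (τ (nth ms i)) Q.- T ∣ Q.≤ δ Q.* T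
    τ-close-at-i = subst (λ n → ∣ toℚ (τ n) Q.- T ∣ Q.≤ δ Q.* T) (sym mᵢ≡m) τ-close

    step-at-i : suc i < rval x N η → ∣ toℚ (nth ms (suc i)) Q.- (toℚ (nth ms i) Q.- T) ∣ Q.≤ δ Q.* T
    step-at-i si<r = begin
      ∣ toℚ (nth ms (suc i)) Q.- (toℚ (nth ms i) Q.- T) ∣ ≡⟨ cong₂ (λ a b → ∣ toℚ a Q.- (toℚ b Q.- T) ∣) mᵢ₊₁≡ mᵢ≡m ⟩
      ∣ toℚ (m ℕ.∸ τ m) Q.- (toℚ m Q.- T) ∣              ≡⟨ cong ∣_∣ (n∸t-[n-T]≡-[t-T] m (τ m) T (τ≤n m)) ⟩
      ∣ Q.- (toℚ (τ m) Q.- T) ∣                          ≡⟨ QP.∣-p∣≡∣p∣ _ ⟩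
      ∣ toℚ (τ m) Q.- T ∣                                ≤⟨ τ-close ⟩
      δ Q.* T                                            ∎
      where
      open QP.≤-Reasoning
      si<n : suc i < length js
      si<n = subst (suc i <_) (LP.length-map (orbit x) js) si<r
      next : nth js (suc i) ≡ suc (nth js i)
      next = decidable-stable (nth js (suc i) ≟ suc (nth js i)) (λ ¬next → no-gap (si<n , ¬next))
      mᵢ₊₁≡ : nth ms (suc i) ≡ m ℕ.∸ τ m
      mᵢ₊₁≡ = trans (nth-map (orbit x) js (suc i) si<n) (cong (orbit x) next)

  badCount≤gaps : ∀ {δ} → η Q.≤ δ → badCount x N η δ ≤ gaps (Aset x N η)
  badCount≤gaps {δ} η≤δ =
    subst (λ n → length (filter bad? (upTo n)) ≤ gaps js) (sym (LP.length-map (orbit x) js))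
      (count-≤-gaps bad? id js (λ i i<n bad →
         decidable-stable (gap? js i) (λ no-gap → bad (good-unless-gap η≤δ i i<n no-gap))))
    where
    js : List ℕ
    js = Aset x N η
    bad? : Decidable (λ i → ¬ Good x N η δ i)
    bad? i = ¬? (good? x N η δ i)

  gaps≤rejected : gaps (Aset x N η) ≤ rejected close? (window x N)
  gaps≤rejected = subst (λ ws → gaps (filter close? ws) ≤ rejected close? ws) (sym (window≡iterate x N))
                        (gaps-filter-iterate close? (jPlus x N) (V x N))

  V≡r+rejected : V x N ≡ rval x N η ℕ.+ rejected close? (window x N)
  V≡r+rejected = begin
    V x N                                ≡⟨ sym (length-window x N) ⟩
    length (window x N)                  ≡⟨ sym (accepted+rejected close? (window x N)) ⟩
    length (Aset x N η) ℕ.+ b            ≡⟨ cong (ℕ._+ b) (sym (LP.length-map (orbit x) (Aset x N η))) ⟩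
    rval x N η ℕ.+ b                     ∎
    where
    open ≡-Reasoning
    b : ℕ
    b = rejected close? (window x N)

  rejected≤Vσ : ∀ {σ} → 0ℚ Q.≤ η → 0ℚ Q.≤ σ → 0 < V x N →
    Var x N Q.≤ σ Q.* ((η Q.* Tval x N) Q.* (η Q.* Tval x N)) →
    toℚ (rejected close? (window x N)) Q.≤ toℚ (V x N) Q.* σ
  rejected≤Vσ {σ} 0≤η 0≤σ 0<V Var≤σe² =
    chebyshev (deviation x N) e 0≤e (window x N) (toℚ (V x N) Q.* σ) (0≤p*q (0≤toℚ (V x N)) 0≤σ) (begin
      sumOfSquares (deviation x N) e (window x N) ≡⟨ sym (toℚ-*-divℕ _ (V x N) 0<V) ⟩
      toℚ (V x N) Q.* Var x N                     ≤⟨ QP.*-monoˡ-≤-nonNeg (toℚ (V x N)) {{Q.nonNegative (0≤toℚ (V x N))}} Var≤σe² ⟩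
      toℚ (V x N) Q.* (σ Q.* (e Q.* e))           ≡⟨ sym (QP.*-assoc (toℚ (V x N)) σ (e Q.* e)) ⟩
      toℚ (V x N) Q.* σ Q.* (e Q.* e)             ∎)
    where
    open QP.≤-Reasoning
    e : ℚ
    e = η Q.* Tval x N
    0≤e : 0ℚ Q.≤ e
    0≤e = 0≤p*q 0≤η (0≤Tval x N)

b≤[r+b]σ⇒b≤δr : ∀ {b r σ δ} → 0ℚ Q.≤ b → 0ℚ Q.≤ r → 0ℚ Q.≤ δ → σ Q.+ σ Q.* δ Q.≤ δ →
  b Q.≤ (r Q.+ b) Q.* σ → b Q.≤ δ Q.* r
b≤[r+b]σ⇒b≤δr {b} {r} {σ} {δ} 0≤b 0≤r 0≤δ σ+σδ≤δ b≤[r+b]σ = begin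
  b                                           ≡⟨ sym (p+q-q≡p b (b Q.* δ)) ⟩
  (b Q.+ b Q.* δ) Q.- b Q.* δ                 ≤⟨ QP.+-monoˡ-≤ (Q.- (b Q.* δ)) b+bδ≤[r+b]δ ⟩
  (r Q.+ b) Q.* δ Q.- b Q.* δ                 ≡⟨ [r+b]δ-bδ≡δr r b δ ⟩
  δ Q.* r                                     ∎
  where
  open QP.≤-Reasoning
  [r+b]δ-bδ≡δr : ∀ r b δ → (r Q.+ b) Q.* δ Q.- b Q.* δ ≡ δ Q.* r
  [r+b]δ-bδ≡δr = solve 3 (λ r b δ → (r :+ b) :* δ :- b :* δ := δ :* r) refl
  factor : ∀ s σ δ → s Q.* σ Q.+ s Q.* σ Q.* δ ≡ s Q.* (σ Q.+ σ Q.* δ)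
  factor = solve 3 (λ s σ δ → s :* σ :+ s :* σ :* δ := s :* (σ :+ σ :* δ)) refl
  0≤r+b : 0ℚ Q.≤ r Q.+ b
  0≤r+b = QP.≤-trans 0≤r (p≤p+q r 0≤b)
  b+bδ≤[r+b]δ : b Q.+ b Q.* δ Q.≤ (r Q.+ b) Q.* δ
  b+bδ≤[r+b]δ = begin
    b Q.+ b Q.* δ                                    ≤⟨ QP.+-mono-≤ b≤[r+b]σ (QP.*-monoʳ-≤-nonNeg δ {{Q.nonNegative 0≤δ}} b≤[r+b]σ) ⟩
    (r Q.+ b) Q.* σ Q.+ (r Q.+ b) Q.* σ Q.* δ        ≡⟨ factor (r Q.+ b) σ δ ⟩
    (r Q.+ b) Q.* (σ Q.+ σ Q.* δ)                    ≤⟨ QP.*-monoˡ-≤-nonNeg (r Q.+ b) {{Q.nonNegative 0≤r+b}} σ+σδ≤δ ⟩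
    (r Q.+ b) Q.* δ                                  ∎

badCount≤δr : ∀ x N {η δ σ} → 0ℚ Q.≤ η → η Q.≤ δ → 0ℚ Q.≤ σ → σ Q.+ σ Q.* δ Q.≤ δ → 0 < V x N →
  Var x N Q.≤ σ Q.* ((η Q.* Tval x N) Q.* (η Q.* Tval x N)) →
  toℚ (badCount x N η δ) Q.≤ δ Q.* toℚ (rval x N η)
badCount≤δr x N {η} {δ} {σ} 0≤η η≤δ 0≤σ σ+σδ≤δ 0<V Var≤σe² =
  QP.≤-trans (toℚ-mono-≤ badCount≤b)
             (b≤[r+b]σ⇒b≤δr {toℚ b} {toℚ r} {σ} {δ} (0≤toℚ b) (0≤toℚ r) (QP.≤-trans 0≤η η≤δ) σ+σδ≤δ b≤[r+b]σ)
  where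
  r b : ℕ
  r = rval x N η
  b = rejected (close? x N η) (window x N)
  badCount≤b : badCount x N η δ ≤ b
  badCount≤b = ℕP.≤-trans (badCount≤gaps x N η η≤δ) (gaps≤rejected x N η)
  b≤Vσ : toℚ b Q.≤ toℚ (V x N) Q.* σ
  b≤Vσ = rejected≤Vσ x N η 0≤η 0≤σ 0<V Var≤σe²
  b≤[r+b]σ : toℚ b Q.≤ (toℚ r Q.+ toℚ b) Q.* σ
  b≤[r+b]σ = subst (λ v → toℚ b Q.≤ v Q.* σ) (trans (cong toℚ (V≡r+rejected x N η)) (toℚ-+ r b)) b≤Vσ

∃ρ²+ρ²δ≤δ : ∀ {δ} → 0ℚ Q.< δ → ∃ λ ρ → 0ℚ Q.< ρ × ρ Q.* ρ Q.+ (ρ Q.* ρ) Q.* δ Q.≤ δ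
∃ρ²+ρ²δ≤δ {δ} 0<δ = ρ , 0<ρ , (begin
    σ Q.+ σ Q.* δ         ≤⟨ QP.+-mono-≤ (QP.≤-trans σ≤ρ (QP.p⊓q≤p (δ Q.* ½) ½))
                                         (QP.*-monoʳ-≤-nonNeg δ {{Q.nonNegative (QP.<⇒≤ 0<δ)}} (QP.≤-trans σ≤ρ ρ≤½)) ⟩
    δ Q.* ½ Q.+ ½ Q.* δ   ≡⟨ halves δ ⟩
    δ                     ∎)
  where
  open QP.≤-Reasoning
  ρ σ : ℚ
  ρ = (δ Q.* ½) Q.⊓ ½
  σ = ρ Q.* ρ
  0<½ : 0ℚ Q.< ½
  0<½ = toWitness {a? = 0ℚ QP.<? ½} _
  0<ρ : 0ℚ Q.< ρ
  0<ρ with QP.⊓-sel (δ Q.* ½) ½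
  ... | inj₁ ρ≡δ½ = subst (0ℚ Q.<_) (sym ρ≡δ½) (QP.positive⁻¹ _ {{QP.pos*pos⇒pos δ {{Q.positive 0<δ}} ½ {{Q.positive 0<½}}}})
  ... | inj₂ ρ≡½  = subst (0ℚ Q.<_) (sym ρ≡½) 0<½
  ρ≤½ : ρ Q.≤ ½
  ρ≤½ = QP.p⊓q≤q (δ Q.* ½) ½
  σ≤ρ : σ Q.≤ ρ
  σ≤ρ = subst (σ Q.≤_) (QP.*-identityʳ ρ)
          (QP.*-monoˡ-≤-nonNeg ρ {{Q.nonNegative (QP.<⇒≤ 0<ρ)}} (QP.≤-trans ρ≤½ (toWitness {a? = ½ QP.≤? Q.1ℚ} _)))
  halves : ∀ δ → δ Q.* ½ Q.+ ½ Q.* δ ≡ δ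
  halves = solve 1 (λ δ → δ :* con ½ :+ con ½ :* δ := δ) refl

∣ε∣≤ρη⇒ε²T²≤ρ²[ηT]² : ∀ {ε ρ η} T → ∣ ε ∣ Q.≤ ρ Q.* η →
  (ε Q.* ε) Q.* (T Q.* T) Q.≤ (ρ Q.* ρ) Q.* ((η Q.* T) Q.* (η Q.* T))
∣ε∣≤ρη⇒ε²T²≤ρ²[ηT]² {ε} {ρ} {η} T ∣ε∣≤ρη = begin
  (ε Q.* ε) Q.* (T Q.* T)                  ≤⟨ QP.*-monoʳ-≤-nonNeg (T Q.* T) {{Q.nonNegative (0≤p*p T)}} (∣p∣≤q⇒p*p≤q*q ∣ε∣≤ρη) ⟩
  ((ρ Q.* η) Q.* (ρ Q.* η)) Q.* (T Q.* T)  ≡⟨ regroup ρ η T ⟩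
  (ρ Q.* ρ) Q.* ((η Q.* T) Q.* (η Q.* T))  ∎
  where
  open QP.≤-Reasoning
  regroup : ∀ ρ η T → ((ρ Q.* η) Q.* (ρ Q.* η)) Q.* (T Q.* T) ≡ (ρ Q.* ρ) Q.* ((η Q.* T) Q.* (η Q.* T))
  regroup = solve 3 (λ ρ η T → ((ρ :* η) :* (ρ :* η)) :* (T :* T) := (ρ :* ρ) :* ((η :* T) :* (η :* T))) refl

mainTheorem17 :
    (ε η : ℕ → ℚ) → TendsToZero ε → TendsToZero η → (∀ N → Q.0ℚ Q.< η N) → RatioToZero ε η →
    (c C : ℚ) → Q.0ℚ Q.< c → Q.0ℚ Q.< C →
    (δ : ℚ) → Q.0ℚ Q.< δ →
    ∃ λ N₀ → ∀ (N x : ℕ) → N₀ ≤ N → 1 ≤ N →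
      0 < V x N →
      Var x N Q.≤ (ε N Q.* ε N) Q.* (Tval x N Q.* Tval x N) →
      c Q.* toℚ N Q.≤ toℚ (rval x N (η N)) Q.* Tval x N →
      toℚ (rval x N (η N)) Q.* Tval x N Q.≤ C Q.* toℚ N →
      toℚ (badCount x N (η N) δ) Q.≤ δ Q.* toℚ (rval x N (η N))
mainTheorem17 ε η _ η→0 0<η ε/η→0 _ _ _ _ δ 0<δ = N₁ ⊔ N₂ , λ N x N₀≤N _ 0<V Var≤ε²T² _ _ →
  badCount≤δr x N {η N} {δ} {ρ Q.* ρ} (QP.<⇒≤ (0<η N)) (η≤δ N (ℕP.m⊔n≤o⇒m≤o N₁ N₂ N₀≤N)) (0≤p*p ρ) ρ²+ρ²δ≤δ 0<V
    (Var≤ρ²[ηT]² N x (ℕP.m⊔n≤o⇒n≤o N₁ N₂ N₀≤N) Var≤ε²T²)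
  where
  ρ : ℚ
  ρ = proj₁ (∃ρ²+ρ²δ≤δ 0<δ)
  0<ρ : 0ℚ Q.< ρ
  0<ρ = proj₁ (proj₂ (∃ρ²+ρ²δ≤δ 0<δ))
  ρ²+ρ²δ≤δ : ρ Q.* ρ Q.+ (ρ Q.* ρ) Q.* δ Q.≤ δ
  ρ²+ρ²δ≤δ = proj₂ (proj₂ (∃ρ²+ρ²δ≤δ 0<δ))
  N₁ N₂ : ℕ
  N₁ = proj₁ (η→0 δ 0<δ)
  N₂ = proj₁ (ε/η→0 ρ 0<ρ)
  η≤δ : ∀ N → N₁ ≤ N → η N Q.≤ δ
  η≤δ N N₁≤N = subst (Q._≤ δ) (QP.0≤p⇒∣p∣≡p (QP.<⇒≤ (0<η N))) (proj₂ (η→0 δ 0<δ) N N₁≤N)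
  ∣ε∣≤ρη : ∀ N → N₂ ≤ N → ∣ ε N ∣ Q.≤ ρ Q.* η N
  ∣ε∣≤ρη = proj₂ (ε/η→0 ρ 0<ρ)
  Var≤ρ²[ηT]² : ∀ N x → N₂ ≤ N → Var x N Q.≤ (ε N Q.* ε N) Q.* (Tval x N Q.* Tval x N) →
    Var x N Q.≤ (ρ Q.* ρ) Q.* ((η N Q.* Tval x N) Q.* (η N Q.* Tval x N))
  Var≤ρ²[ηT]² N x N₂≤N Var≤ε²T² =
    QP.≤-trans {Var x N} {(ε N Q.* ε N) Q.* (Tval x N Q.* Tval x N)} Var≤ε²T²
      (∣ε∣≤ρη⇒ε²T²≤ρ²[ηT]² {ε N} {ρ} {η N} (Tval x N) (∣ε∣≤ρη N N₂≤N))
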